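{- Writing $2=1+1$, $3=1+1+1$, $5=1+1+1+1+1$, let $\phi_{2,3,5}$ be the conditional equation $\frac{0}{2}\cdot\frac{0}{3}=\frac{0}{2}\cdot\frac{0}{5}\to\frac{0}{3}=\frac{0}{5}$. Then $E_{\mathsf{ftc-cm}}\cup\{\mathsf{AVL}\}\not\vdash\phi_{2,3,5}$.
   Context: $\Sigma$ is the signature with constants $0,1,\bot$, unary $-$, binary $+,\cdot,\div$; $x\div y$ is written $\frac{x}{y}$. $E_{\mathsf{ftc-cm}}$ is the following set of equations: $(x+y)+z=x+(y+z)$; $x+y=y+x$; $x+0=x$; $x+(-x)=0\cdot x$; $x\cdot(y\cdot z)=(x\cdot y)\cdot z$; $x\cdot y=y\cdot x$; $1\cdot x=x$; $x\cdot(y+z)=(x\cdot y)+(x\cdot z)$; $-(-x)=x$; $0\cdot(x\cdot x)=0\cdot x$; $x+\bot=\bot$; $x=\frac{x}{1}$; $\frac{x}{y}\cdot\frac{u}{v}=\frac{x\cdot u}{y\cdot v}$; $\frac{x}{y}+\frac{u}{v}=\frac{(x\cdot v)+(y\cdot u)}{y\cdot v}$; $\frac{x}{y+(0\cdot z)}=\frac{x+(0\cdot z)}{y}$; $\bot=\frac{1}{0}$. $\mathsf{AVL}$ is the conditional equation $\frac{1}{x}=\bot\to 0\cdot x=x$. $\vdash$ is derivability in conditional equational logic (equivalently first order logic). -}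

module Defs where

open import Data.Nat using (ℕ)

data Term : Set where
  var  : ℕ → Term
  𝟎 𝟏 ⊥t : Term
  neg  : Term → Term
  _⊕_ _⊙_ _⊘_ : Term → Term → Term

infixl 6 _⊕_
infixl 7 _⊙_
infixl 8 _⊘_

sub : (ℕ → Term) → Term → Term
sub σ (var n)  = σ n
sub σ 𝟎        = 𝟎
sub σ 𝟏        = 𝟏
sub σ ⊥t       = ⊥t
sub σ (neg t)  = neg (sub σ t)
sub σ (t ⊕ u)  = sub σ t ⊕ sub σ u
sub σ (t ⊙ u)  = sub σ t ⊙ sub σ u
sub σ (t ⊘ u)  = sub σ t ⊘ sub σ u

private
  x y z u v : Term
  x = var 0
  y = var 1
  z = var 2
  u = var 3
  v = var 4

-- The equations of E_ftc-cm (each constructor is one axiom  l = r).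
data Eftc : Term → Term → Set where
  e1  : Eftc ((x ⊕ y) ⊕ z) (x ⊕ (y ⊕ z))
  e2  : Eftc (x ⊕ y) (y ⊕ x)
  e3  : Eftc (x ⊕ 𝟎) x
  e4  : Eftc (x ⊕ neg x) (𝟎 ⊙ x)
  e5  : Eftc (x ⊙ (y ⊙ z)) ((x ⊙ y) ⊙ z)
  e6  : Eftc (x ⊙ y) (y ⊙ x)
  e7  : Eftc (𝟏 ⊙ x) x
  e8  : Eftc (x ⊙ (y ⊕ z)) ((x ⊙ y) ⊕ (x ⊙ z))
  e9  : Eftc (neg (neg x)) x
  e10 : Eftc (𝟎 ⊙ (x ⊙ x)) (𝟎 ⊙ x)
  e11 : Eftc (x ⊕ ⊥t) ⊥t
  e12 : Eftc x (x ⊘ 𝟏)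
  e13 : Eftc ((x ⊘ y) ⊙ (u ⊘ v)) ((x ⊙ u) ⊘ (y ⊙ v))
  e14 : Eftc ((x ⊘ y) ⊕ (u ⊘ v)) (((x ⊙ v) ⊕ (y ⊙ u)) ⊘ (y ⊙ v))
  e15 : Eftc (x ⊘ (y ⊕ (𝟎 ⊙ z))) ((x ⊕ (𝟎 ⊙ z)) ⊘ y)
  e16 : Eftc ⊥t (𝟏 ⊘ 𝟎)

-- Derivability in conditional equational logic from E_ftc-cm ∪ {AVL},
-- relative to a set H of extra hypotheses (equations between terms in
-- which variables are treated as constants, i.e. not substituted into).
data _⊢_≈_ (H : Term → Term → Set) : Term → Term → Set where
  hyp    : ∀ {s t} → H s t → H ⊢ s ≈ t
  axiom  : ∀ {l r} → Eftc l r → (σ : ℕ → Term) → H ⊢ sub σ l ≈ sub σ r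
  avl    : ∀ a → H ⊢ (𝟏 ⊘ a) ≈ ⊥t → H ⊢ (𝟎 ⊙ a) ≈ a
  refl   : ∀ {s} → H ⊢ s ≈ s
  sym    : ∀ {s t} → H ⊢ s ≈ t → H ⊢ t ≈ s
  trans  : ∀ {s t w} → H ⊢ s ≈ t → H ⊢ t ≈ w → H ⊢ s ≈ w
  cong-neg : ∀ {s t} → H ⊢ s ≈ t → H ⊢ neg s ≈ neg t
  cong-⊕ : ∀ {s s' t t'} → H ⊢ s ≈ s' → H ⊢ t ≈ t' → H ⊢ (s ⊕ t) ≈ (s' ⊕ t')
  cong-⊙ : ∀ {s s' t t'} → H ⊢ s ≈ s' → H ⊢ t ≈ t' → H ⊢ (s ⊙ t) ≈ (s' ⊙ t')
  cong-⊘ : ∀ {s s' t t'} → H ⊢ s ≈ s' → H ⊢ t ≈ t' → H ⊢ (s ⊘ t) ≈ (s' ⊘ t')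

-- A conditional equation  s = t → l = r ;  it is derivable iff l = r is
-- derivable with s = t as an extra (unsubstitutable) hypothesis.
data Single (s t : Term) : Term → Term → Set where
  here : Single s t s t


Derivable : Term → Term → Term → Term → Set
Derivable s t l r = Single s t ⊢ l ≈ r

two three five : Term
two   = 𝟏 ⊕ 𝟏
three = 𝟏 ⊕ 𝟏 ⊕ 𝟏
five  = 𝟏 ⊕ 𝟏 ⊕ 𝟏 ⊕ 𝟏 ⊕ 𝟏

φ235-derivable : Set
φ235-derivable =
  Derivable ((𝟎 ⊘ two) ⊙ (𝟎 ⊘ three)) ((𝟎 ⊘ two) ⊙ (𝟎 ⊘ five))
            (𝟎 ⊘ three) (𝟎 ⊘ five)

-- Countermodel.  Take pairs ⟨ q , w ⟩ of a rational q and an element w of ℤ/6 extended by an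
-- error element, together with a single ⊥, and let +, · and - act componentwise.  Dividing ⟨ a , w ⟩
-- by ⟨ b , v ⟩ gives ⊥ when b = 0, and otherwise ⟨ a / b , w · v⁻¹ ⟩, where w · v⁻¹ is the error
-- element unless v is a unit mod 6.  This satisfies E_ftc-cm.  AVL fails in general, but holds
-- on every value of a term: there w is either the error element or the residue mod 6 of q,
-- so q = 0 forces w ∈ {0, error}.  Finally 0/2 and 0/3 are ⟨ 0 , error ⟩ while 0/5 = ⟨ 0 , 0 ⟩,
-- so the premise of φ_{2,3,5} holds and its conclusion fails.
module Submission where

open import Data.Empty using (⊥-elim)
open import Data.Fin using (Fin; zero; suc; toℕ)
import Data.Fin.Properties as Fin
open import Data.Integer as ℤ using (ℤ; +_; -[1+_])
import Data.Integer.Properties as ℤ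
open import Data.Maybe as Maybe using (Maybe; just; nothing; zipWith)
import Data.Maybe.Properties as Maybe
open import Data.Nat as ℕ using (ℕ; zero; suc; _∸_)
open import Data.Nat.DivMod using (_mod_)
open import Data.Product using (_,_)
open import Data.Rational as ℚ using (ℚ; 0ℚ; 1ℚ; _+_; _*_; -_; 1/_; _÷_; NonZero; ≢-nonZero)
open import Data.Rational.Literals using (fromℤ)
import Data.Rational.Properties as ℚ
open import Data.Rational.Solver using (module +-*-Solver)
import Data.Rational.Unnormalised as ℚᵘ
import Data.Rational.Unnormalised.Properties as ℚᵘ
open import Algebra.Properties.Group ℚ.+-0-group using (⁻¹-involutive)
open import Relation.Binary using (DecidableEquality)
open import Relation.Binary.PropositionalEquality
open import Relation.Nullary using (¬_; Dec; yes; no; _→-dec_; _×-dec_; map′)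
open import Relation.Nullary.Decidable using (from-yes)
open import Relation.Unary using (Decidable)

open import Defs hiding (sym; trans)
import Defs as D

open ≡-Reasoning

ℤ₆ : Set
ℤ₆ = Fin 6

0₆ 1₆ : ℤ₆
0₆ = zero
1₆ = suc zero

infixl 6 _+₆_
infixl 7 _*₆_
infix  8 -₆_

_+₆_ _*₆_ : ℤ₆ → ℤ₆ → ℤ₆
a +₆ b = (toℕ a ℕ.+ toℕ b) mod 6
a *₆ b = (toℕ a ℕ.* toℕ b) mod 6

-₆_ : ℤ₆ → ℤ₆
-₆ a = (6 ∸ toℕ a) mod 6

-- The units 1 and 5 of ℤ/6 are exactly the solutions of u² = 1, so each is its own inverse.
IsUnit : ℤ₆ → Set
IsUnit u = u *₆ u ≡ 1₆

unit? : ∀ u → Dec (IsUnit u)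
unit? u = u *₆ u Fin.≟ 1₆

+₆-identityˡ : ∀ a → 0₆ +₆ a ≡ a
+₆-identityˡ = from-yes (Fin.all? λ a → 0₆ +₆ a Fin.≟ a)

+₆-assoc : ∀ a b c → a +₆ b +₆ c ≡ a +₆ (b +₆ c)
+₆-assoc = from-yes (Fin.all? λ a → Fin.all? λ b → Fin.all? λ c →
  a +₆ b +₆ c Fin.≟ a +₆ (b +₆ c))

-₆-involutive : ∀ a → -₆ -₆ a ≡ a
-₆-involutive = from-yes (Fin.all? λ a → -₆ -₆ a Fin.≟ a)

-₆-1+ : ∀ a → -₆ a ≡ 1₆ +₆ -₆ (1₆ +₆ a)
-₆-1+ = from-yes (Fin.all? λ a → -₆ a Fin.≟ 1₆ +₆ -₆ (1₆ +₆ a))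

+₆-cancelˡ : ∀ a b c → b ≡ a +₆ c → c ≡ -₆ a +₆ b
+₆-cancelˡ = from-yes (Fin.all? λ a → Fin.all? λ b → Fin.all? λ c →
  (b Fin.≟ a +₆ c) →-dec (c Fin.≟ -₆ a +₆ b))

*₆-zeroˡ : ∀ a → 0₆ *₆ a ≡ 0₆
*₆-zeroˡ = from-yes (Fin.all? λ a → 0₆ *₆ a Fin.≟ 0₆)

1+-*₆ : ∀ a b → (1₆ +₆ a) *₆ b ≡ b +₆ a *₆ b
1+-*₆ = from-yes (Fin.all? λ a → Fin.all? λ b → (1₆ +₆ a) *₆ b Fin.≟ b +₆ a *₆ b)

-₆-distribˡ-*₆ : ∀ a b → -₆ (a *₆ b) ≡ -₆ a *₆ b
-₆-distribˡ-*₆ = from-yes (Fin.all? λ a → Fin.all? λ b → -₆ (a *₆ b) Fin.≟ -₆ a *₆ b)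

*₆-interchange : ∀ w v d e → w *₆ d *₆ (v *₆ e) ≡ w *₆ v *₆ (d *₆ e)
*₆-interchange = from-yes (Fin.all? λ w → Fin.all? λ v → Fin.all? λ d → Fin.all? λ e →
  w *₆ d *₆ (v *₆ e) Fin.≟ w *₆ v *₆ (d *₆ e))

*₆-+₆-interchange : ∀ w v d e → w *₆ d *₆ e +₆ v *₆ e *₆ d ≡ (w +₆ v) *₆ (d *₆ e)
*₆-+₆-interchange = from-yes (Fin.all? λ w → Fin.all? λ v → Fin.all? λ d → Fin.all? λ e →
  w *₆ d *₆ e +₆ v *₆ e *₆ d Fin.≟ (w +₆ v) *₆ (d *₆ e))

unit-* : ∀ u v → IsUnit u → IsUnit v → IsUnit (u *₆ v)
unit-* = from-yes (Fin.all? λ u → Fin.all? λ v → unit? u →-dec unit? v →-dec unit? (u *₆ v))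

unit-swap : ∀ v d n → IsUnit v → n ≡ v *₆ d → d ≡ v *₆ n
unit-swap = from-yes (Fin.all? λ v → Fin.all? λ d → Fin.all? λ n →
  unit? v →-dec (n Fin.≟ v *₆ d) →-dec (d Fin.≟ v *₆ n))

unit-annihilator : ∀ u w → IsUnit u → 0₆ ≡ w *₆ u → w ≡ 0₆
unit-annihilator = from-yes (Fin.all? λ u → Fin.all? λ w →
  unit? u →-dec (0₆ Fin.≟ w *₆ u) →-dec (w Fin.≟ 0₆))

πℕ : ℕ → ℤ₆
πℕ zero    = 0₆
πℕ (suc n) = 1₆ +₆ πℕ n

π : ℤ → ℤ₆
π (+ n)    = πℕ n
π -[1+ n ] = -₆ πℕ (suc n)

π-suc : ∀ x → π (ℤ.suc x) ≡ 1₆ +₆ π x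
π-suc (+ n)          = refl
π-suc -[1+ zero ]    = refl
π-suc -[1+ suc n ]   = -₆-1+ (πℕ (suc n))

π-+-pos : ∀ n y → π (+ n ℤ.+ y) ≡ πℕ n +₆ π y
π-+-pos zero y = trans (cong π (ℤ.+-identityˡ y)) (sym (+₆-identityˡ (π y)))
π-+-pos (suc n) y = begin
  π (+ suc n ℤ.+ y)        ≡⟨ cong π (ℤ.suc-+ n y) ⟩
  π (ℤ.suc (+ n ℤ.+ y))    ≡⟨ π-suc (+ n ℤ.+ y) ⟩
  1₆ +₆ π (+ n ℤ.+ y)      ≡⟨ cong (1₆ +₆_) (π-+-pos n y) ⟩
  1₆ +₆ (πℕ n +₆ π y)      ≡⟨ sym (+₆-assoc 1₆ (πℕ n) (π y)) ⟩
  πℕ (suc n) +₆ π y        ∎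

π-+ : ∀ x y → π (x ℤ.+ y) ≡ π x +₆ π y
π-+ (+ n)    y = π-+-pos n y
π-+ -[1+ n ] y = +₆-cancelˡ (πℕ (suc n)) (π y) (π (-[1+ n ] ℤ.+ y)) (begin
  π y                                   ≡⟨ cong π (sym cancel) ⟩
  π (+ suc n ℤ.+ (-[1+ n ] ℤ.+ y))      ≡⟨ π-+-pos (suc n) (-[1+ n ] ℤ.+ y) ⟩
  πℕ (suc n) +₆ π (-[1+ n ] ℤ.+ y)      ∎)
  where
  cancel : + suc n ℤ.+ (-[1+ n ] ℤ.+ y) ≡ y
  cancel = begin
    + suc n ℤ.+ (-[1+ n ] ℤ.+ y)   ≡⟨ sym (ℤ.+-assoc (+ suc n) -[1+ n ] y) ⟩
    (+ suc n ℤ.+ -[1+ n ]) ℤ.+ y   ≡⟨ cong (ℤ._+ y) (ℤ.+-inverseʳ (+ suc n)) ⟩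
    + 0 ℤ.+ y                      ≡⟨ ℤ.+-identityˡ y ⟩
    y                              ∎

π-neg : ∀ x → π (ℤ.- x) ≡ -₆ π x
π-neg (+ zero)   = refl
π-neg (+ suc n)  = refl
π-neg -[1+ n ]   = sym (-₆-involutive (πℕ (suc n)))

π-*-pos : ∀ n y → π (+ n ℤ.* y) ≡ πℕ n *₆ π y
π-*-pos zero y = trans (cong π (ℤ.*-zeroˡ y)) (sym (*₆-zeroˡ (π y)))
π-*-pos (suc n) y = begin
  π (ℤ.suc (+ n) ℤ.* y)        ≡⟨ cong π (ℤ.suc-* (+ n) y) ⟩
  π (y ℤ.+ + n ℤ.* y)          ≡⟨ π-+ y (+ n ℤ.* y) ⟩
  π y +₆ π (+ n ℤ.* y)         ≡⟨ cong (π y +₆_) (π-*-pos n y) ⟩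
  π y +₆ πℕ n *₆ π y           ≡⟨ sym (1+-*₆ (πℕ n) (π y)) ⟩
  πℕ (suc n) *₆ π y            ∎

π-* : ∀ x y → π (x ℤ.* y) ≡ π x *₆ π y
π-* (+ n)    y = π-*-pos n y
π-* -[1+ n ] y = begin
  π (-[1+ n ] ℤ.* y)           ≡⟨ cong π (sym (ℤ.neg-distribˡ-* (+ suc n) y)) ⟩
  π (ℤ.- (+ suc n ℤ.* y))      ≡⟨ π-neg (+ suc n ℤ.* y) ⟩
  -₆ π (+ suc n ℤ.* y)         ≡⟨ cong -₆_ (π-*-pos (suc n) y) ⟩
  -₆ (πℕ (suc n) *₆ π y)       ≡⟨ -₆-distribˡ-*₆ (πℕ (suc n)) (π y) ⟩
  π -[1+ n ] *₆ π y            ∎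

fromℤ-+ : ∀ m n → fromℤ (m ℤ.+ n) ≡ fromℤ m + fromℤ n
fromℤ-+ m n = ℚ.toℚᵘ-injective (ℚᵘ.≃-sym (ℚᵘ.≃-trans (ℚ.toℚᵘ-homo-+ (fromℤ m) (fromℤ n))
  (ℚᵘ.*≡* (cong (ℤ._* ℤ.1ℤ) (cong₂ ℤ._+_ (ℤ.*-identityʳ m) (ℤ.*-identityʳ n))))))

fromℤ-* : ∀ m n → fromℤ (m ℤ.* n) ≡ fromℤ m * fromℤ n
fromℤ-* m n = ℚ.toℚᵘ-injective (ℚᵘ.≃-sym (ℚ.toℚᵘ-homo-* (fromℤ m) (fromℤ n)))

fromℤ-neg : ∀ n → fromℤ (ℤ.- n) ≡ - fromℤ n
fromℤ-neg n = ℚ.toℚᵘ-injective (ℚᵘ.≃-sym (ℚ.toℚᵘ-homo‿- (fromℤ n)))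

record Residue (a : ℚ) (w : ℤ₆) : Set where
  constructor residue
  field
    num den  : ℤ
    den-unit : IsUnit (π den)
    num-mod6 : π num ≡ w *₆ π den
    a*den    : a * fromℤ den ≡ fromℤ num

residue-0 : Residue 0ℚ 0₆
residue-0 = residue (+ 0) (+ 1) refl refl refl

residue-1 : Residue 1ℚ 1₆
residue-1 = residue (+ 1) (+ 1) refl refl refl

module _ {a b : ℚ} {w v : ℤ₆} (ra : Residue a w) (rb : Residue b v) where
  open +-*-Solver
  open Residue ra renaming (num to n₁; den to d₁; den-unit to u₁; num-mod6 to c₁; a*den to e₁)
  open Residue rb renaming (num to n₂; den to d₂; den-unit to u₂; num-mod6 to c₂; a*den to e₂)

  residue-+ : Residue (a + b) (w +₆ v)
  residue-+ = residue (n₁ ℤ.* d₂ ℤ.+ n₂ ℤ.* d₁) (d₁ ℤ.* d₂)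
    (subst IsUnit (sym (π-* d₁ d₂)) (unit-* (π d₁) (π d₂) u₁ u₂))
    (begin
      π (n₁ ℤ.* d₂ ℤ.+ n₂ ℤ.* d₁)                      ≡⟨ π-+ (n₁ ℤ.* d₂) (n₂ ℤ.* d₁) ⟩
      π (n₁ ℤ.* d₂) +₆ π (n₂ ℤ.* d₁)                   ≡⟨ cong₂ _+₆_ (π-* n₁ d₂) (π-* n₂ d₁) ⟩
      π n₁ *₆ π d₂ +₆ π n₂ *₆ π d₁                     ≡⟨ cong₂ (λ p q → p *₆ π d₂ +₆ q *₆ π d₁) c₁ c₂ ⟩
      w *₆ π d₁ *₆ π d₂ +₆ v *₆ π d₂ *₆ π d₁           ≡⟨ *₆-+₆-interchange w v (π d₁) (π d₂) ⟩
      (w +₆ v) *₆ (π d₁ *₆ π d₂)                       ≡⟨ cong ((w +₆ v) *₆_) (sym (π-* d₁ d₂)) ⟩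
      (w +₆ v) *₆ π (d₁ ℤ.* d₂)                        ∎)
    (begin
      (a + b) * fromℤ (d₁ ℤ.* d₂)                      ≡⟨ cong ((a + b) *_) (fromℤ-* d₁ d₂) ⟩
      (a + b) * (fromℤ d₁ * fromℤ d₂)                  ≡⟨ solve 4 (λ a b p q → (a :+ b) :* (p :* q) :=
                                                            a :* p :* q :+ b :* q :* p) refl a b (fromℤ d₁) (fromℤ d₂) ⟩
      a * fromℤ d₁ * fromℤ d₂ + b * fromℤ d₂ * fromℤ d₁ ≡⟨ cong₂ (λ p q → p * fromℤ d₂ + q * fromℤ d₁) e₁ e₂ ⟩
      fromℤ n₁ * fromℤ d₂ + fromℤ n₂ * fromℤ d₁        ≡⟨ sym (cong₂ _+_ (fromℤ-* n₁ d₂) (fromℤ-* n₂ d₁)) ⟩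
      fromℤ (n₁ ℤ.* d₂) + fromℤ (n₂ ℤ.* d₁)            ≡⟨ sym (fromℤ-+ (n₁ ℤ.* d₂) (n₂ ℤ.* d₁)) ⟩
      fromℤ (n₁ ℤ.* d₂ ℤ.+ n₂ ℤ.* d₁)                  ∎)

  residue-* : Residue (a * b) (w *₆ v)
  residue-* = residue (n₁ ℤ.* n₂) (d₁ ℤ.* d₂)
    (subst IsUnit (sym (π-* d₁ d₂)) (unit-* (π d₁) (π d₂) u₁ u₂))
    (begin
      π (n₁ ℤ.* n₂)                    ≡⟨ π-* n₁ n₂ ⟩
      π n₁ *₆ π n₂                     ≡⟨ cong₂ _*₆_ c₁ c₂ ⟩
      w *₆ π d₁ *₆ (v *₆ π d₂)         ≡⟨ *₆-interchange w v (π d₁) (π d₂) ⟩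
      w *₆ v *₆ (π d₁ *₆ π d₂)         ≡⟨ cong (w *₆ v *₆_) (sym (π-* d₁ d₂)) ⟩
      w *₆ v *₆ π (d₁ ℤ.* d₂)          ∎)
    (begin
      a * b * fromℤ (d₁ ℤ.* d₂)            ≡⟨ cong (a * b *_) (fromℤ-* d₁ d₂) ⟩
      a * b * (fromℤ d₁ * fromℤ d₂)        ≡⟨ solve 4 (λ a b p q → a :* b :* (p :* q) :=
                                                a :* p :* (b :* q)) refl a b (fromℤ d₁) (fromℤ d₂) ⟩
      a * fromℤ d₁ * (b * fromℤ d₂)        ≡⟨ cong₂ _*_ e₁ e₂ ⟩
      fromℤ n₁ * fromℤ n₂                  ≡⟨ sym (fromℤ-* n₁ n₂) ⟩
      fromℤ (n₁ ℤ.* n₂)                    ∎)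

residue-neg : ∀ {a w} → Residue a w → Residue (- a) (-₆ w)
residue-neg {a} {w} (residue n d u c e) = residue (ℤ.- n) d u
  (begin
    π (ℤ.- n)            ≡⟨ π-neg n ⟩
    -₆ π n               ≡⟨ cong -₆_ c ⟩
    -₆ (w *₆ π d)        ≡⟨ -₆-distribˡ-*₆ w (π d) ⟩
    -₆ w *₆ π d          ∎)
  (begin
    - a * fromℤ d        ≡⟨ sym (ℚ.neg-distribˡ-* a (fromℤ d)) ⟩
    - (a * fromℤ d)      ≡⟨ cong -_ e ⟩
    - fromℤ n            ≡⟨ sym (fromℤ-neg n) ⟩
    fromℤ (ℤ.- n)        ∎)

-- If b = n / d then 1 / b = d / n, and v⁻¹ = v.
residue-1/ : ∀ {b v} .{{_ : NonZero b}} → IsUnit v → Residue b v → Residue (1/ b) v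
residue-1/ {b} {v} uv (residue n d u c e) = residue d n
  (subst IsUnit (sym c) (unit-* v (π d) uv u))
  (unit-swap v (π d) (π n) uv c)
  (begin
    1/ b * fromℤ n               ≡⟨ cong (1/ b *_) (sym e) ⟩
    1/ b * (b * fromℤ d)         ≡⟨ sym (ℚ.*-assoc (1/ b) b (fromℤ d)) ⟩
    1/ b * b * fromℤ d           ≡⟨ cong (_* fromℤ d) (ℚ.*-inverseˡ b) ⟩
    1ℚ * fromℤ d                 ≡⟨ ℚ.*-identityˡ (fromℤ d) ⟩
    fromℤ d                      ∎)

residue-of-0≡0₆ : ∀ {w} → Residue 0ℚ w → w ≡ 0₆
residue-of-0≡0₆ {w} (residue n d u c e) = unit-annihilator (π d) w u (begin
  0₆              ≡⟨ cong π n≡0 ⟩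
  π n             ≡⟨ c ⟩
  w *₆ π d        ∎)
  where
  n≡0 : + 0 ≡ n
  n≡0 = cong ℚ.↥_ (trans (sym (ℚ.*-zeroˡ (fromℤ d))) e)

p+0*q≡p : ∀ p q → p + 0ℚ * q ≡ p
p+0*q≡p p q = trans (cong (_+_ p) (ℚ.*-zeroˡ q)) (ℚ.+-identityʳ p)

*-≢0 : ∀ {p q} → p ≢ 0ℚ → q ≢ 0ℚ → p * q ≢ 0ℚ
*-≢0 {p} {q} p≢0 q≢0 pq≡0 = q≢0 (begin
  q                ≡⟨ sym (ℚ.*-identityˡ q) ⟩
  1ℚ * q           ≡⟨ cong (_* q) (sym (ℚ.*-inverseˡ p)) ⟩
  1/ p * p * q     ≡⟨ ℚ.*-assoc (1/ p) p q ⟩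
  1/ p * (p * q)   ≡⟨ cong (1/ p *_) pq≡0 ⟩
  1/ p * 0ℚ        ≡⟨ ℚ.*-zeroʳ (1/ p) ⟩
  0ℚ               ∎)
  where instance _ = ≢-nonZero p≢0

module _ (b d : ℚ) .{{_ : NonZero b}} .{{_ : NonZero d}} .{{_ : NonZero (b * d)}} where
  open +-*-Solver

  1/-distrib-* : 1/ (b * d) ≡ 1/ b * 1/ d
  1/-distrib-* = begin
    1/ (b * d)                              ≡⟨ sym (ℚ.*-identityʳ (1/ (b * d))) ⟩
    1/ (b * d) * 1ℚ                         ≡⟨ cong (1/ (b * d) *_) (sym bd*[1/b*1/d]≡1) ⟩
    1/ (b * d) * (b * d * (1/ b * 1/ d))    ≡⟨ sym (ℚ.*-assoc (1/ (b * d)) (b * d) (1/ b * 1/ d)) ⟩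
    1/ (b * d) * (b * d) * (1/ b * 1/ d)    ≡⟨ cong (_* (1/ b * 1/ d)) (ℚ.*-inverseˡ (b * d)) ⟩
    1ℚ * (1/ b * 1/ d)                      ≡⟨ ℚ.*-identityˡ (1/ b * 1/ d) ⟩
    1/ b * 1/ d                             ∎
    where
    bd*[1/b*1/d]≡1 : b * d * (1/ b * 1/ d) ≡ 1ℚ
    bd*[1/b*1/d]≡1 = begin
      b * d * (1/ b * 1/ d)    ≡⟨ solve 4 (λ b d b' d' → b :* d :* (b' :* d') := b :* b' :* (d :* d'))
                                    refl b d (1/ b) (1/ d) ⟩
      b * 1/ b * (d * 1/ d)    ≡⟨ cong₂ _*_ (ℚ.*-inverseʳ b) (ℚ.*-inverseʳ d) ⟩
      1ℚ                       ∎

  ÷-*-÷ : ∀ a c → (a ÷ b) * (c ÷ d) ≡ (a * c) ÷ (b * d)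
  ÷-*-÷ a c = begin
    a * 1/ b * (c * 1/ d)    ≡⟨ solve 4 (λ a b' c d' → a :* b' :* (c :* d') := a :* c :* (b' :* d'))
                                  refl a (1/ b) c (1/ d) ⟩
    a * c * (1/ b * 1/ d)    ≡⟨ cong (a * c *_) (sym 1/-distrib-*) ⟩
    a * c * 1/ (b * d)       ∎

  ÷-+-÷ : ∀ a c → a ÷ b + c ÷ d ≡ (a * d + b * c) ÷ (b * d)
  ÷-+-÷ a c = begin
    a * 1/ b + c * 1/ d                            ≡⟨ solve 6 (λ a b' c d' b d →
                                                        a :* b' :+ c :* d' := a :* b' :* con 1ℚ :+ c :* d' :* con 1ℚ)
                                                        refl a (1/ b) c (1/ d) b d ⟩
    a * 1/ b * 1ℚ + c * 1/ d * 1ℚ                  ≡⟨ cong₂ (λ p q → a * 1/ b * p + c * 1/ d * q)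
                                                        (sym (ℚ.*-inverseʳ d)) (sym (ℚ.*-inverseʳ b)) ⟩
    a * 1/ b * (d * 1/ d) + c * 1/ d * (b * 1/ b)  ≡⟨ solve 6 (λ a b' c d' b d →
                                                        a :* b' :* (d :* d') :+ c :* d' :* (b :* b') :=
                                                        (a :* d :+ b :* c) :* (b' :* d'))
                                                        refl a (1/ b) c (1/ d) b d ⟩
    (a * d + b * c) * (1/ b * 1/ d)                ≡⟨ cong ((a * d + b * c) *_) (sym 1/-distrib-*) ⟩
    (a * d + b * c) * 1/ (b * d)                   ∎

-- ℤ/6 extended by an error element, nothing
W : Set
W = Maybe ℤ₆

infixl 6 _+ᵂ_
infixl 7 _*ᵂ_ _÷ᵂ_
infix  8 -ᵂ_

_+ᵂ_ _*ᵂ_ _÷ᵂ_ : W → W → W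
_+ᵂ_ = zipWith _+₆_
_*ᵂ_ = zipWith _*₆_
just w ÷ᵂ just v with unit? v
... | yes _ = just (w *₆ v)
... | no  _ = nothing
_ ÷ᵂ _ = nothing

-ᵂ_ : W → W
-ᵂ_ = Maybe.map -₆_

0ᵂ 1ᵂ : W
0ᵂ = just 0₆
1ᵂ = just 1₆

infix 4 _≟ᵂ_
_≟ᵂ_ : DecidableEquality W
_≟ᵂ_ = Maybe.≡-dec Fin._≟_

allᵂ? : ∀ {P : W → Set} → Decidable P → Dec (∀ w → P w)
allᵂ? P? = map′ (λ { (p , q) nothing → p ; (p , q) (just i) → q i })
                (λ ∀P → ∀P nothing , λ i → ∀P (just i))
                (P? nothing ×-dec Fin.all? (λ i → P? (just i)))

+ᵂ-assoc : ∀ w v u → w +ᵂ v +ᵂ u ≡ w +ᵂ (v +ᵂ u)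
+ᵂ-assoc = from-yes (allᵂ? λ w → allᵂ? λ v → allᵂ? λ u → w +ᵂ v +ᵂ u ≟ᵂ w +ᵂ (v +ᵂ u))

+ᵂ-comm : ∀ w v → w +ᵂ v ≡ v +ᵂ w
+ᵂ-comm = from-yes (allᵂ? λ w → allᵂ? λ v → w +ᵂ v ≟ᵂ v +ᵂ w)

+ᵂ-identityʳ : ∀ w → w +ᵂ 0ᵂ ≡ w
+ᵂ-identityʳ = from-yes (allᵂ? λ w → w +ᵂ 0ᵂ ≟ᵂ w)

+ᵂ-inverseʳ : ∀ w → w +ᵂ -ᵂ w ≡ 0ᵂ *ᵂ w
+ᵂ-inverseʳ = from-yes (allᵂ? λ w → w +ᵂ -ᵂ w ≟ᵂ 0ᵂ *ᵂ w)

*ᵂ-assoc : ∀ w v u → w *ᵂ (v *ᵂ u) ≡ w *ᵂ v *ᵂ u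
*ᵂ-assoc = from-yes (allᵂ? λ w → allᵂ? λ v → allᵂ? λ u → w *ᵂ (v *ᵂ u) ≟ᵂ w *ᵂ v *ᵂ u)

*ᵂ-comm : ∀ w v → w *ᵂ v ≡ v *ᵂ w
*ᵂ-comm = from-yes (allᵂ? λ w → allᵂ? λ v → w *ᵂ v ≟ᵂ v *ᵂ w)

*ᵂ-identityˡ : ∀ w → 1ᵂ *ᵂ w ≡ w
*ᵂ-identityˡ = from-yes (allᵂ? λ w → 1ᵂ *ᵂ w ≟ᵂ w)

*ᵂ-distribˡ-+ᵂ : ∀ w v u → w *ᵂ (v +ᵂ u) ≡ w *ᵂ v +ᵂ w *ᵂ u
*ᵂ-distribˡ-+ᵂ = from-yes (allᵂ? λ w → allᵂ? λ v → allᵂ? λ u → w *ᵂ (v +ᵂ u) ≟ᵂ w *ᵂ v +ᵂ w *ᵂ u)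

-ᵂ-involutive : ∀ w → -ᵂ -ᵂ w ≡ w
-ᵂ-involutive = from-yes (allᵂ? λ w → -ᵂ -ᵂ w ≟ᵂ w)

0*ᵂ-square : ∀ w → 0ᵂ *ᵂ (w *ᵂ w) ≡ 0ᵂ *ᵂ w
0*ᵂ-square = from-yes (allᵂ? λ w → 0ᵂ *ᵂ (w *ᵂ w) ≟ᵂ 0ᵂ *ᵂ w)

÷ᵂ-identityʳ : ∀ w → w ≡ w ÷ᵂ 1ᵂ
÷ᵂ-identityʳ = from-yes (allᵂ? λ w → w ≟ᵂ w ÷ᵂ 1ᵂ)

÷ᵂ-*ᵂ-÷ᵂ : ∀ w v u t → (w ÷ᵂ v) *ᵂ (u ÷ᵂ t) ≡ (w *ᵂ u) ÷ᵂ (v *ᵂ t)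
÷ᵂ-*ᵂ-÷ᵂ = from-yes (allᵂ? λ w → allᵂ? λ v → allᵂ? λ u → allᵂ? λ t →
  (w ÷ᵂ v) *ᵂ (u ÷ᵂ t) ≟ᵂ (w *ᵂ u) ÷ᵂ (v *ᵂ t))

÷ᵂ-+ᵂ-÷ᵂ : ∀ w v u t → w ÷ᵂ v +ᵂ u ÷ᵂ t ≡ (w *ᵂ t +ᵂ v *ᵂ u) ÷ᵂ (v *ᵂ t)
÷ᵂ-+ᵂ-÷ᵂ = from-yes (allᵂ? λ w → allᵂ? λ v → allᵂ? λ u → allᵂ? λ t →
  w ÷ᵂ v +ᵂ u ÷ᵂ t ≟ᵂ (w *ᵂ t +ᵂ v *ᵂ u) ÷ᵂ (v *ᵂ t))

÷ᵂ-+ᵂ-0*ᵂ : ∀ w v u → w ÷ᵂ (v +ᵂ 0ᵂ *ᵂ u) ≡ (w +ᵂ 0ᵂ *ᵂ u) ÷ᵂ v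
÷ᵂ-+ᵂ-0*ᵂ = from-yes (allᵂ? λ w → allᵂ? λ v → allᵂ? λ u →
  w ÷ᵂ (v +ᵂ 0ᵂ *ᵂ u) ≟ᵂ (w +ᵂ 0ᵂ *ᵂ u) ÷ᵂ v)

data M : Set where
  ⊥ₘ    : M
  ⟨_,_⟩ : ℚ → W → M

0ₘ 1ₘ : M
0ₘ = ⟨ 0ℚ , 0ᵂ ⟩
1ₘ = ⟨ 1ℚ , 1ᵂ ⟩

pointwise : (ℚ → ℚ → ℚ) → (ℤ₆ → ℤ₆ → ℤ₆) → M → M → M
pointwise f g ⟨ a , w ⟩ ⟨ b , v ⟩ = ⟨ f a b , zipWith g w v ⟩
pointwise f g _         _         = ⊥ₘ

infixl 6 _+ₘ_
infixl 7 _*ₘ_ _÷ₘ_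
infix  8 -ₘ_

_+ₘ_ _*ₘ_ _÷ₘ_ : M → M → M
_+ₘ_ = pointwise _+_ _+₆_
_*ₘ_ = pointwise _*_ _*₆_
⟨ a , w ⟩ ÷ₘ ⟨ b , v ⟩ with b ℚ.≟ 0ℚ
... | yes _   = ⊥ₘ
... | no b≢0  = ⟨ (a ÷ b) {{≢-nonZero b≢0}} , w ÷ᵂ v ⟩
_ ÷ₘ _ = ⊥ₘ

-ₘ_ : M → M
-ₘ ⊥ₘ        = ⊥ₘ
-ₘ ⟨ a , w ⟩ = ⟨ - a , -ᵂ w ⟩

+ₘ-assoc : ∀ x y z → x +ₘ y +ₘ z ≡ x +ₘ (y +ₘ z)
+ₘ-assoc ⟨ a , w ⟩ ⟨ b , v ⟩ ⟨ c , u ⟩ = cong₂ ⟨_,_⟩ (ℚ.+-assoc a b c) (+ᵂ-assoc w v u)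
+ₘ-assoc ⊥ₘ        _         _         = refl
+ₘ-assoc ⟨ _ , _ ⟩ ⊥ₘ        _         = refl
+ₘ-assoc ⟨ _ , _ ⟩ ⟨ _ , _ ⟩ ⊥ₘ        = refl

+ₘ-comm : ∀ x y → x +ₘ y ≡ y +ₘ x
+ₘ-comm ⟨ a , w ⟩ ⟨ b , v ⟩ = cong₂ ⟨_,_⟩ (ℚ.+-comm a b) (+ᵂ-comm w v)
+ₘ-comm ⊥ₘ        ⊥ₘ        = refl
+ₘ-comm ⊥ₘ        ⟨ _ , _ ⟩ = refl
+ₘ-comm ⟨ _ , _ ⟩ ⊥ₘ        = refl

+ₘ-identityʳ : ∀ x → x +ₘ 0ₘ ≡ x
+ₘ-identityʳ ⊥ₘ        = refl
+ₘ-identityʳ ⟨ a , w ⟩ = cong₂ ⟨_,_⟩ (ℚ.+-identityʳ a) (+ᵂ-identityʳ w)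

+ₘ-inverseʳ : ∀ x → x +ₘ -ₘ x ≡ 0ₘ *ₘ x
+ₘ-inverseʳ ⊥ₘ        = refl
+ₘ-inverseʳ ⟨ a , w ⟩ =
  cong₂ ⟨_,_⟩ (trans (ℚ.+-inverseʳ a) (sym (ℚ.*-zeroˡ a))) (+ᵂ-inverseʳ w)

*ₘ-assoc : ∀ x y z → x *ₘ (y *ₘ z) ≡ x *ₘ y *ₘ z
*ₘ-assoc ⟨ a , w ⟩ ⟨ b , v ⟩ ⟨ c , u ⟩ = cong₂ ⟨_,_⟩ (sym (ℚ.*-assoc a b c)) (*ᵂ-assoc w v u)
*ₘ-assoc ⊥ₘ        _         _         = refl
*ₘ-assoc ⟨ _ , _ ⟩ ⊥ₘ        _         = refl
*ₘ-assoc ⟨ _ , _ ⟩ ⟨ _ , _ ⟩ ⊥ₘ        = refl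

*ₘ-comm : ∀ x y → x *ₘ y ≡ y *ₘ x
*ₘ-comm ⟨ a , w ⟩ ⟨ b , v ⟩ = cong₂ ⟨_,_⟩ (ℚ.*-comm a b) (*ᵂ-comm w v)
*ₘ-comm ⊥ₘ        ⊥ₘ        = refl
*ₘ-comm ⊥ₘ        ⟨ _ , _ ⟩ = refl
*ₘ-comm ⟨ _ , _ ⟩ ⊥ₘ        = refl

*ₘ-identityˡ : ∀ x → 1ₘ *ₘ x ≡ x
*ₘ-identityˡ ⊥ₘ        = refl
*ₘ-identityˡ ⟨ a , w ⟩ = cong₂ ⟨_,_⟩ (ℚ.*-identityˡ a) (*ᵂ-identityˡ w)

*ₘ-distribˡ-+ₘ : ∀ x y z → x *ₘ (y +ₘ z) ≡ x *ₘ y +ₘ x *ₘ z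
*ₘ-distribˡ-+ₘ ⟨ a , w ⟩ ⟨ b , v ⟩ ⟨ c , u ⟩ =
  cong₂ ⟨_,_⟩ (ℚ.*-distribˡ-+ a b c) (*ᵂ-distribˡ-+ᵂ w v u)
*ₘ-distribˡ-+ₘ ⊥ₘ        _         _         = refl
*ₘ-distribˡ-+ₘ ⟨ _ , _ ⟩ ⊥ₘ        _         = refl
*ₘ-distribˡ-+ₘ ⟨ _ , _ ⟩ ⟨ _ , _ ⟩ ⊥ₘ        = refl

-ₘ-involutive : ∀ x → -ₘ -ₘ x ≡ x
-ₘ-involutive ⊥ₘ        = refl
-ₘ-involutive ⟨ a , w ⟩ = cong₂ ⟨_,_⟩ (⁻¹-involutive a) (-ᵂ-involutive w)

0*ₘ-square : ∀ x → 0ₘ *ₘ (x *ₘ x) ≡ 0ₘ *ₘ x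
0*ₘ-square ⊥ₘ        = refl
0*ₘ-square ⟨ a , w ⟩ =
  cong₂ ⟨_,_⟩ (trans (ℚ.*-zeroˡ (a * a)) (sym (ℚ.*-zeroˡ a))) (0*ᵂ-square w)

+ₘ-zeroʳ : ∀ x → x +ₘ ⊥ₘ ≡ ⊥ₘ
+ₘ-zeroʳ ⊥ₘ        = refl
+ₘ-zeroʳ ⟨ _ , _ ⟩ = refl

÷ₘ-zeroʳ : ∀ x → x ÷ₘ ⊥ₘ ≡ ⊥ₘ
÷ₘ-zeroʳ ⊥ₘ        = refl
÷ₘ-zeroʳ ⟨ _ , _ ⟩ = refl

÷ₘ-identityʳ : ∀ x → x ≡ x ÷ₘ 1ₘ
÷ₘ-identityʳ ⊥ₘ        = refl
÷ₘ-identityʳ ⟨ a , w ⟩ = cong₂ ⟨_,_⟩ (sym (ℚ.*-identityʳ a)) (÷ᵂ-identityʳ w)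

÷ₘ-*ₘ-÷ₘ : ∀ x y u v → (x ÷ₘ y) *ₘ (u ÷ₘ v) ≡ (x *ₘ u) ÷ₘ (y *ₘ v)
÷ₘ-*ₘ-÷ₘ ⊥ₘ        _         _         _  = refl
÷ₘ-*ₘ-÷ₘ ⟨ a , w ⟩ ⊥ₘ        u         _  = sym (÷ₘ-zeroʳ (⟨ a , w ⟩ *ₘ u))
÷ₘ-*ₘ-÷ₘ ⟨ a , w ⟩ ⟨ b , _ ⟩ ⊥ₘ        _  with b ℚ.≟ 0ℚ
... | yes _ = refl
... | no  _ = refl
÷ₘ-*ₘ-÷ₘ ⟨ a , w ⟩ ⟨ b , _ ⟩ ⟨ _ , _ ⟩ ⊥ₘ with b ℚ.≟ 0ℚ
... | yes _ = refl
... | no  _ = refl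
÷ₘ-*ₘ-÷ₘ ⟨ a , w ⟩ ⟨ b , s ⟩ ⟨ c , t ⟩ ⟨ d , r ⟩ with b ℚ.≟ 0ℚ | d ℚ.≟ 0ℚ | b * d ℚ.≟ 0ℚ
... | yes _   | _       | yes _    = refl
... | yes b≡0 | _       | no bd≢0  = ⊥-elim (bd≢0 (trans (cong (_* d) b≡0) (ℚ.*-zeroˡ d)))
... | no _    | yes _   | yes _    = refl
... | no _    | yes d≡0 | no bd≢0  = ⊥-elim (bd≢0 (trans (cong (b *_) d≡0) (ℚ.*-zeroʳ b)))
... | no b≢0  | no d≢0  | yes bd≡0 = ⊥-elim (*-≢0 b≢0 d≢0 bd≡0)
... | no b≢0  | no d≢0  | no bd≢0  = cong₂ ⟨_,_⟩
  (÷-*-÷ b d {{≢-nonZero b≢0}} {{≢-nonZero d≢0}} {{≢-nonZero bd≢0}} a c) (÷ᵂ-*ᵂ-÷ᵂ w s t r)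

÷ₘ-+ₘ-÷ₘ : ∀ x y u v → x ÷ₘ y +ₘ u ÷ₘ v ≡ (x *ₘ v +ₘ y *ₘ u) ÷ₘ (y *ₘ v)
÷ₘ-+ₘ-÷ₘ ⊥ₘ        _         _         _  = refl
÷ₘ-+ₘ-÷ₘ ⟨ a , w ⟩ ⊥ₘ        u         v  = sym (÷ₘ-zeroʳ (⟨ a , w ⟩ *ₘ v +ₘ ⊥ₘ))
÷ₘ-+ₘ-÷ₘ ⟨ a , w ⟩ ⟨ b , _ ⟩ ⊥ₘ        v  rewrite +ₘ-zeroʳ (⟨ a , w ⟩ *ₘ v) with b ℚ.≟ 0ℚ
... | yes _ = refl
... | no  _ = refl
÷ₘ-+ₘ-÷ₘ ⟨ a , w ⟩ ⟨ b , _ ⟩ ⟨ _ , _ ⟩ ⊥ₘ with b ℚ.≟ 0ℚ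
... | yes _ = refl
... | no  _ = refl
÷ₘ-+ₘ-÷ₘ ⟨ a , w ⟩ ⟨ b , s ⟩ ⟨ c , t ⟩ ⟨ d , r ⟩ with b ℚ.≟ 0ℚ | d ℚ.≟ 0ℚ | b * d ℚ.≟ 0ℚ
... | yes _   | _       | yes _    = refl
... | yes b≡0 | _       | no bd≢0  = ⊥-elim (bd≢0 (trans (cong (_* d) b≡0) (ℚ.*-zeroˡ d)))
... | no _    | yes _   | yes _    = refl
... | no _    | yes d≡0 | no bd≢0  = ⊥-elim (bd≢0 (trans (cong (b *_) d≡0) (ℚ.*-zeroʳ b)))
... | no b≢0  | no d≢0  | yes bd≡0 = ⊥-elim (*-≢0 b≢0 d≢0 bd≡0)
... | no b≢0  | no d≢0  | no bd≢0  = cong₂ ⟨_,_⟩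
  (÷-+-÷ b d {{≢-nonZero b≢0}} {{≢-nonZero d≢0}} {{≢-nonZero bd≢0}} a c) (÷ᵂ-+ᵂ-÷ᵂ w s t r)

÷ₘ-+ₘ-0*ₘ : ∀ x y z → x ÷ₘ (y +ₘ 0ₘ *ₘ z) ≡ (x +ₘ 0ₘ *ₘ z) ÷ₘ y
÷ₘ-+ₘ-0*ₘ ⊥ₘ        _         _  = refl
÷ₘ-+ₘ-0*ₘ ⟨ a , w ⟩ ⊥ₘ        z  = sym (÷ₘ-zeroʳ (⟨ a , w ⟩ +ₘ 0ₘ *ₘ z))
÷ₘ-+ₘ-0*ₘ ⟨ a , w ⟩ ⟨ b , _ ⟩ ⊥ₘ with b ℚ.≟ 0ℚ
... | yes _ = refl
... | no  _ = refl
÷ₘ-+ₘ-0*ₘ ⟨ a , w ⟩ ⟨ b , v ⟩ ⟨ c , u ⟩ rewrite p+0*q≡p b c | p+0*q≡p a c with b ℚ.≟ 0ℚ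
... | yes _ = refl
... | no  _ = cong ⟨ _ ,_⟩ (÷ᵂ-+ᵂ-0*ᵂ w v u)

1÷ₘ0 : ⊥ₘ ≡ 1ₘ ÷ₘ 0ₘ
1÷ₘ0 = refl

data Coherent : M → Set where
  ⊥-coherent       : Coherent ⊥ₘ
  error-coherent   : ∀ a → Coherent ⟨ a , nothing ⟩
  residue-coherent : ∀ {a w} → Residue a w → Coherent ⟨ a , just w ⟩

coherent-pointwise : ∀ {f g x y} → (∀ {a b w v} → Residue a w → Residue b v → Residue (f a b) (g w v)) →
                     Coherent x → Coherent y → Coherent (pointwise f g x y)
coherent-pointwise _ ⊥-coherent             _                      = ⊥-coherent
coherent-pointwise _ (error-coherent _)     ⊥-coherent             = ⊥-coherent
coherent-pointwise _ (error-coherent _)     (error-coherent _)     = error-coherent _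
coherent-pointwise _ (error-coherent _)     (residue-coherent _)   = error-coherent _
coherent-pointwise _ (residue-coherent _)   ⊥-coherent             = ⊥-coherent
coherent-pointwise _ (residue-coherent _)   (error-coherent _)     = error-coherent _
coherent-pointwise h (residue-coherent ra)  (residue-coherent rb)  = residue-coherent (h ra rb)

coherent-neg : ∀ {x} → Coherent x → Coherent (-ₘ x)
coherent-neg ⊥-coherent            = ⊥-coherent
coherent-neg (error-coherent _)    = error-coherent _
coherent-neg (residue-coherent r)  = residue-coherent (residue-neg r)

coherent-÷ : ∀ {x y} → Coherent x → Coherent y → Coherent (x ÷ₘ y)
coherent-÷ ⊥-coherent _ = ⊥-coherent
coherent-÷ (error-coherent _) ⊥-coherent = ⊥-coherent
coherent-÷ (residue-coherent _) ⊥-coherent = ⊥-coherent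
coherent-÷ (error-coherent _) (error-coherent b) with b ℚ.≟ 0ℚ
... | yes _ = ⊥-coherent
... | no  _ = error-coherent _
coherent-÷ (error-coherent _) (residue-coherent {b} _) with b ℚ.≟ 0ℚ
... | yes _ = ⊥-coherent
... | no  _ = error-coherent _
coherent-÷ (residue-coherent _) (error-coherent b) with b ℚ.≟ 0ℚ
... | yes _ = ⊥-coherent
... | no  _ = error-coherent _
coherent-÷ (residue-coherent ra) (residue-coherent {b} {v} rb) with b ℚ.≟ 0ℚ
... | yes _   = ⊥-coherent
... | no b≢0  with unit? v
...   | yes u = residue-coherent (residue-* ra (residue-1/ {{≢-nonZero b≢0}} u rb))
...   | no  _ = error-coherent _

avl-coherent : ∀ {x} → Coherent x → 1ₘ ÷ₘ x ≡ ⊥ₘ → 0ₘ *ₘ x ≡ x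
avl-coherent ⊥-coherent _ = refl
avl-coherent (error-coherent b) 1/x≡⊥ with b ℚ.≟ 0ℚ
... | yes refl = refl
avl-coherent (error-coherent b) () | no _
avl-coherent (residue-coherent {b} r) 1/x≡⊥ with b ℚ.≟ 0ℚ
... | yes refl rewrite residue-of-0≡0₆ r = refl
avl-coherent (residue-coherent {b} r) () | no _

eval : (ℕ → M) → Term → M
eval ρ (var n) = ρ n
eval ρ 𝟎       = 0ₘ
eval ρ 𝟏       = 1ₘ
eval ρ ⊥t      = ⊥ₘ
eval ρ (neg t) = -ₘ eval ρ t
eval ρ (t ⊕ u) = eval ρ t +ₘ eval ρ u
eval ρ (t ⊙ u) = eval ρ t *ₘ eval ρ u
eval ρ (t ⊘ u) = eval ρ t ÷ₘ eval ρ u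

eval-sub : ∀ ρ σ t → eval ρ (sub σ t) ≡ eval (λ n → eval ρ (σ n)) t
eval-sub ρ σ (var n) = refl
eval-sub ρ σ 𝟎       = refl
eval-sub ρ σ 𝟏       = refl
eval-sub ρ σ ⊥t      = refl
eval-sub ρ σ (neg t) = cong -ₘ_ (eval-sub ρ σ t)
eval-sub ρ σ (t ⊕ u) = cong₂ _+ₘ_ (eval-sub ρ σ t) (eval-sub ρ σ u)
eval-sub ρ σ (t ⊙ u) = cong₂ _*ₘ_ (eval-sub ρ σ t) (eval-sub ρ σ u)
eval-sub ρ σ (t ⊘ u) = cong₂ _÷ₘ_ (eval-sub ρ σ t) (eval-sub ρ σ u)

Eftc-sound : ∀ {l r} → Eftc l r → ∀ ρ → eval ρ l ≡ eval ρ r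
Eftc-sound e1  ρ = +ₘ-assoc (ρ 0) (ρ 1) (ρ 2)
Eftc-sound e2  ρ = +ₘ-comm (ρ 0) (ρ 1)
Eftc-sound e3  ρ = +ₘ-identityʳ (ρ 0)
Eftc-sound e4  ρ = +ₘ-inverseʳ (ρ 0)
Eftc-sound e5  ρ = *ₘ-assoc (ρ 0) (ρ 1) (ρ 2)
Eftc-sound e6  ρ = *ₘ-comm (ρ 0) (ρ 1)
Eftc-sound e7  ρ = *ₘ-identityˡ (ρ 0)
Eftc-sound e8  ρ = *ₘ-distribˡ-+ₘ (ρ 0) (ρ 1) (ρ 2)
Eftc-sound e9  ρ = -ₘ-involutive (ρ 0)
Eftc-sound e10 ρ = 0*ₘ-square (ρ 0)
Eftc-sound e11 ρ = +ₘ-zeroʳ (ρ 0)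
Eftc-sound e12 ρ = ÷ₘ-identityʳ (ρ 0)
Eftc-sound e13 ρ = ÷ₘ-*ₘ-÷ₘ (ρ 0) (ρ 1) (ρ 3) (ρ 4)
Eftc-sound e14 ρ = ÷ₘ-+ₘ-÷ₘ (ρ 0) (ρ 1) (ρ 3) (ρ 4)
Eftc-sound e15 ρ = ÷ₘ-+ₘ-0*ₘ (ρ 0) (ρ 1) (ρ 2)
Eftc-sound e16 ρ = 1÷ₘ0

module _ {ρ : ℕ → M} (ρ-coherent : ∀ n → Coherent (ρ n)) where

  eval-coherent : ∀ t → Coherent (eval ρ t)
  eval-coherent (var n) = ρ-coherent n
  eval-coherent 𝟎       = residue-coherent residue-0
  eval-coherent 𝟏       = residue-coherent residue-1
  eval-coherent ⊥t      = ⊥-coherent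
  eval-coherent (neg t) = coherent-neg (eval-coherent t)
  eval-coherent (t ⊕ u) = coherent-pointwise residue-+ (eval-coherent t) (eval-coherent u)
  eval-coherent (t ⊙ u) = coherent-pointwise residue-* (eval-coherent t) (eval-coherent u)
  eval-coherent (t ⊘ u) = coherent-÷ (eval-coherent t) (eval-coherent u)

  sound : ∀ {H} → (∀ {s t} → H s t → eval ρ s ≡ eval ρ t) → ∀ {l r} → H ⊢ l ≈ r → eval ρ l ≡ eval ρ r
  sound H-sound (hyp h)                 = H-sound h
  sound H-sound (axiom {l} {r} e σ)     =
    trans (eval-sub ρ σ l) (trans (Eftc-sound e _) (sym (eval-sub ρ σ r)))
  sound H-sound (avl a 1/a≡⊥)           = avl-coherent (eval-coherent a) (sound H-sound 1/a≡⊥)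
  sound H-sound refl                    = refl
  sound H-sound (D.sym p)               = sym (sound H-sound p)
  sound H-sound (D.trans p q)           = trans (sound H-sound p) (sound H-sound q)
  sound H-sound (cong-neg p)            = cong -ₘ_ (sound H-sound p)
  sound H-sound (cong-⊕ p q)            = cong₂ _+ₘ_ (sound H-sound p) (sound H-sound q)
  sound H-sound (cong-⊙ p q)            = cong₂ _*ₘ_ (sound H-sound p) (sound H-sound q)
  sound H-sound (cong-⊘ p q)            = cong₂ _÷ₘ_ (sound H-sound p) (sound H-sound q)

mainTheorem16 : ¬ φ235-derivable
mainTheorem16 derivation with sound {ρ = λ _ → ⊥ₘ} (λ _ → ⊥-coherent) (λ { here → refl }) derivation
... | ()
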